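{- Let $n\ge 6$ and $k$ be integers with $1\le k\le \frac n2-1$, and let $\mathcal{V}^k_n$ be the class of all simple bipartite graphs on $n$ vertices with vertex connectivity exactly $k$. Let $r$ be an integer with $k\le r\le n-1$ such that $G:=O_k\vee_1(K_1\cup K_{n-r-1,r-k})\in\mathcal{V}^k_n$, and suppose $r\le \frac n2-2$ or $r>\frac n2$. Then $G$ does not attain the maximum of $M_1$ over $\mathcal{V}^k_n$ and does not attain the maximum of $M_2$ over $\mathcal{V}^k_n$.
   Context: All graphs are finite, simple and undirected. $M_1(G)=\sum_{u\in V(G)} d(u)^2$ and $M_2(G)=\sum_{uv\in E(G)} d(u)d(v)$, where $d(u)$ is the degree of $u$. The vertex connectivity $\kappa(G)$ is the largest integer $k$ such that $|V(G)|>k$ and $G-X$ is connected for every $X\subseteq V(G)$ with $|X|<k$. $K_{p,q}$ denotes the complete bipartite graph with parts of sizes $p$ and $q$; $K_{p,0}$ ($p\ge1$) is the empty graph on $p$ vertices. For positive integers $n\ge r\ge k$, the graph $O_k\vee_1(K_1\cup K_{n-r-1,r-k})$ is defined as follows: take an independent set $C$ of $k$ vertices, a single vertex $v$, and a complete bipartite graph $K_{n-r-1,r-k}$ with parts $A$ of size $n-r-1$ and $B$ of size $r-k$; add all edges between $C$ and $v$ and all edges between $C$ and $A$. -}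

module Defs where

open import Data.Nat using (ℕ; zero; suc; _+_; _*_; _∸_; _≤_; _<_; _≤ᵇ_; _<ᵇ_; _≡ᵇ_)
open import Data.Bool using (Bool; true; false; if_then_else_; _∧_; not)
open import Data.Fin using (Fin; toℕ)
open import Data.Fin.Subset using (Subset; _∈_; _∉_; ∣_∣)
open import Data.List using (List; map)
open import Data.Nat.ListAction using (sum)
open import Data.List.Base using (allFin)
open import Data.Product using (Σ; ∃; _×_; _,_)
open import Data.Sum using (_⊎_)
open import Relation.Binary.PropositionalEquality using (_≡_; _≢_)
open import Relation.Nullary using (¬_)

record Graph (n : ℕ) : Set where
  field
    adj   : Fin n → Fin n → Bool
    sym   : ∀ i j → adj i j ≡ adj j i
    irrefl : ∀ i → adj i i ≡ false
open Graph public

Adj : ∀ {n} → Graph n → Fin n → Fin n → Set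
Adj G i j = adj G i j ≡ true

deg : ∀ {n} → Graph n → Fin n → ℕ
deg {n} G i = sum (map (λ j → if adj G i j then 1 else 0) (allFin n))

M1 : ∀ {n} → Graph n → ℕ
M1 {n} G = sum (map (λ i → deg G i * deg G i) (allFin n))

-- M₂(G) = Σ_{uv ∈ E} d(u) d(v); each edge counted once via toℕ i < toℕ j
M2 : ∀ {n} → Graph n → ℕ
M2 {n} G = sum (map (λ i → sum (map (λ j →
  if adj G i j ∧ (toℕ i <ᵇ toℕ j) then deg G i * deg G j else 0) (allFin n))) (allFin n))

Bipartite : ∀ {n} → Graph n → Set
Bipartite {n} G = Σ (Fin n → Bool) λ c → ∀ i j → Adj G i j → c i ≢ c j

data ReachAvoid {n} (G : Graph n) (X : Subset n) : Fin n → Fin n → Set where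
  here : ∀ {u} → u ∉ X → ReachAvoid G X u u
  step : ∀ {u w v} → u ∉ X → Adj G u w → ReachAvoid G X w v → ReachAvoid G X u v

ConnectedMinus : ∀ {n} → Graph n → Subset n → Set
ConnectedMinus {n} G X = ∀ u v → u ∉ X → v ∉ X → ReachAvoid G X u v

KConnected : ∀ {n} → Graph n → ℕ → Set
KConnected {n} G k = k < n × (∀ (X : Subset n) → ∣ X ∣ < k → ConnectedMinus G X)

Connectivity≡ : ∀ {n} → Graph n → ℕ → Set
Connectivity≡ G k = KConnected G k × (∀ m → KConnected G m → m ≤ k)

InV : (n k : ℕ) → Graph n → Set
InV n k G = Bipartite G × Connectivity≡ G k

-- The graph O_k ∨₁ (K₁ ∪ K_{n-r-1,r-k}) on Fin n. Vertex labels by toℕ: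
--   0 .. k-1              : C (independent set of size k)
--   k                     : v
--   k+1 .. k+(n-r-1)      : A (size n-r-1)
--   k+(n-r) .. n-1        : B (size r-k)
-- Edges: C–v, C–A, A–B.
data Part : Set where
  pC pv pA pB : Part

part : (n r k : ℕ) → ℕ → Part
part n r k x =
  if x <ᵇ k then pC
  else if x ≡ᵇ k then pv
  else if x ≤ᵇ k + (n ∸ r ∸ 1) then pA
  else pB

partAdj : Part → Part → Bool
partAdj pC pv = true
partAdj pv pC = true
partAdj pC pA = true
partAdj pA pC = true
partAdj pA pB = true
partAdj pB pA = true
partAdj _ _ = false

partAdj-sym : ∀ p q → partAdj p q ≡ partAdj q p
partAdj-sym pC pC = Relation.Binary.PropositionalEquality.refl
partAdj-sym pC pv = Relation.Binary.PropositionalEquality.refl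
partAdj-sym pC pA = Relation.Binary.PropositionalEquality.refl
partAdj-sym pC pB = Relation.Binary.PropositionalEquality.refl
partAdj-sym pv pC = Relation.Binary.PropositionalEquality.refl
partAdj-sym pv pv = Relation.Binary.PropositionalEquality.refl
partAdj-sym pv pA = Relation.Binary.PropositionalEquality.refl
partAdj-sym pv pB = Relation.Binary.PropositionalEquality.refl
partAdj-sym pA pC = Relation.Binary.PropositionalEquality.refl
partAdj-sym pA pv = Relation.Binary.PropositionalEquality.refl
partAdj-sym pA pA = Relation.Binary.PropositionalEquality.refl
partAdj-sym pA pB = Relation.Binary.PropositionalEquality.refl
partAdj-sym pB pC = Relation.Binary.PropositionalEquality.refl
partAdj-sym pB pv = Relation.Binary.PropositionalEquality.refl
partAdj-sym pB pA = Relation.Binary.PropositionalEquality.refl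
partAdj-sym pB pB = Relation.Binary.PropositionalEquality.refl

partAdj-irr : ∀ p → partAdj p p ≡ false
partAdj-irr pC = Relation.Binary.PropositionalEquality.refl
partAdj-irr pv = Relation.Binary.PropositionalEquality.refl
partAdj-irr pA = Relation.Binary.PropositionalEquality.refl
partAdj-irr pB = Relation.Binary.PropositionalEquality.refl

Okv1 : (n r k : ℕ) → Graph n
Okv1 n r k = record
  { adj = λ i j → partAdj (part n r k (toℕ i)) (part n r k (toℕ j))
  ; sym = λ i j → partAdj-sym (part n r k (toℕ i)) (part n r k (toℕ j))
  ; irrefl = λ i → partAdj-irr (part n r k (toℕ i))
  }

AttainsMax : (n k : ℕ) → (Graph n → ℕ) → Graph n → Set
AttainsMax n k f G = InV n k G × (∀ H → InV n k H → f H ≤ f G)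

-- Write G(A,b) for this graph with blocks C (k vertices), v, A (A vertices)
-- and B (b vertices), so that A = n − r − 1 and b = r − k.  Its degrees are
-- d(C) = A+1, d(v) = k, d(A) = k+b, d(B) = A, hence M₁ and M₂ are the
-- explicit polynomials m1 k A b and m2 k A b.  The proof moves one vertex
-- between the blocks A and B, keeping n fixed:
--   * if 2r + 4 ≤ n then A ≥ k + b + 3, and G(A−1, b+1) has larger M₁ and M₂;
--   * if n < 2r then b ≥ 2, membership in 𝒱ⁿ_k forces A ≥ k (the block A
--     separates B from v), and G(A+1, b−1) has larger M₁ and M₂.
-- The competitor lies in 𝒱ⁿ_k because G(A,b) is bipartite with connectivity
-- exactly k whenever 1 ≤ A and k ≤ A.

module Submission where

open import Defs hiding (sym)
open import Data.Bool using (Bool; true; false; if_then_else_; _∧_; T)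
open import Data.Bool.Properties using (T-≡)
open import Data.Empty using (⊥-elim)
open import Data.Fin using (Fin; toℕ; fromℕ<)
open import Data.Fin.Properties using (any?; toℕ-fromℕ<)
open import Data.Fin.Subset using (Subset; _∈_; _∉_; ∣_∣; _⊆_)
open import Data.Fin.Subset.Properties using (_∈?_; p⊆q⇒∣p∣≤∣q∣)
open import Data.List.Base as List using (allFin; _∷_; [])
open import Data.List.Properties using (map-cong; map-tabulate)
open import Data.Nat
open import Data.Nat.ListAction using (sum)
open import Data.Nat.Properties
open import Data.Nat.Tactic.RingSolver using (solve-∀; solve)
open import Data.Product using (∃; ∃₂; _×_; _,_)
open import Data.Sum using (_⊎_; inj₁; inj₂)
import Data.Vec.Base as Vec
open import Data.Vec.Properties using (lookup∘tabulate; []=⇒lookup; lookup⇒[]=)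
open import Function using (_∘_; id)
open import Function.Bundles using (Equivalence)
open import Relation.Binary.Definitions using (tri<; tri≈; tri>)
open import Relation.Binary.PropositionalEquality
open import Relation.Nullary using (¬_; yes; no)
open import Relation.Nullary.Decidable using (_×-dec_; ¬?)
open ≡-Reasoning

true-if-T : ∀ {b} → T b → b ≡ true
true-if-T = Equivalence.to T-≡

false-if-¬T : ∀ {b} → ¬ T b → b ≡ false
false-if-¬T {true}  ¬t = ⊥-elim (¬t _)
false-if-¬T {false} _  = refl

false≢true : false ≢ true
false≢true ()

walk-start : ∀ {n} {G : Graph n} {X u w} → ReachAvoid G X u w → u ∉ X
walk-start (here u∉X)     = u∉X
walk-start (step u∉X _ _) = u∉X

walk-++ : ∀ {n} {G : Graph n} {X u v w} →
  ReachAvoid G X u v → ReachAvoid G X v w → ReachAvoid G X u w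
walk-++ (here _)          later = later
walk-++ (step u∉X e rest) later = step u∉X e (walk-++ rest later)

walk-reverse : ∀ {n} {G : Graph n} {X u w} → ReachAvoid G X u w → ReachAvoid G X w u
walk-reverse (here u∉X) = here u∉X
walk-reverse {G = G} (step {u} {v} u∉X e rest) =
  walk-++ (walk-reverse rest) (step (walk-start rest) (trans (Graph.sym G v u) e) (here u∉X))

N : ∀ {n} → Graph n → Fin n → Subset n
N G u = Vec.tabulate (adj G u)

∈-tabulate : ∀ {n} {f : Fin n → Bool} {i} → i ∈ Vec.tabulate f → f i ≡ true
∈-tabulate {f = f} {i} i∈ = trans (sym (lookup∘tabulate f i)) ([]=⇒lookup i∈)

tabulate-∈ : ∀ {n} {f : Fin n → Bool} {i} → f i ≡ true → i ∈ Vec.tabulate f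
tabulate-∈ {f = f} {i} fi = lookup⇒[]= i _ (trans (lookup∘tabulate f i) fi)

trapped : ∀ {n} {G : Graph n} {X u w} →
  (∀ {v} → Adj G u v → v ∈ X) → ReachAvoid G X u w → w ≡ u
trapped N⊆X (here _)        = refl
trapped N⊆X (step _ e rest) = ⊥-elim (walk-start rest (N⊆X e))

-- κ(G) ≤ |N(u)| as soon as some vertex w ≠ u is not adjacent to u:
-- deleting N(u) separates u from w.
connectivity≤neighbourhood : ∀ {n} {G : Graph n} {m u w} →
  KConnected G m → w ≢ u → ¬ Adj G u w → m ≤ ∣ N G u ∣
connectivity≤neighbourhood {G = G} {m} {u} {w} (_ , connected) w≢u u≁w with m ≤? ∣ N G u ∣
... | yes m≤N = m≤N
... | no  m≰N = ⊥-elim (w≢u (trapped tabulate-∈ (connected (N G u) (≰⇒> m≰N) u w u∉N w∉N)))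
  where
  u∉N : u ∉ N G u
  u∉N u∈N = false≢true (trans (sym (Graph.irrefl G u)) (∈-tabulate u∈N))
  w∉N : w ∉ N G u
  w∉N w∈N = u≁w (∈-tabulate w∈N)

outside : ∀ {n} (S X : Subset n) → ∣ X ∣ < ∣ S ∣ → ∃ λ i → i ∈ S × i ∉ X
outside S X X<S with any? (λ i → (i ∈? S) ×-dec ¬? (i ∈? X))
... | yes found = found
... | no  none  = ⊥-elim (<⇒≱ X<S (p⊆q⇒∣p∣≤∣q∣ S⊆X))
  where
  S⊆X : S ⊆ X
  S⊆X {i} i∈S with i ∈? X
  ... | yes i∈X = i∈X
  ... | no  i∉X = ⊥-elim (none (i , i∈S , i∉X))

beaten : ∀ {n k} (f : Graph n → ℕ) {G H} → InV n k H → f G < f H → ¬ AttainsMax n k f G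
beaten f H∈𝒱 fG<fH (_ , maximal) = <⇒≱ fG<fH (maximal _ H∈𝒱)

sumTo : ℕ → (ℕ → ℕ) → ℕ
sumTo zero    f = 0
sumTo (suc m) f = f 0 + sumTo m (f ∘ suc)

sumTo-+ : ∀ a b f → sumTo (a + b) f ≡ sumTo a f + sumTo b (λ x → f (a + x))
sumTo-+ zero    b f = refl
sumTo-+ (suc a) b f = trans (cong (f 0 +_) (sumTo-+ a b (f ∘ suc))) (sym (+-assoc (f 0) _ _))

sumTo-const : ∀ m f c → (∀ {x} → x < m → f x ≡ c) → sumTo m f ≡ m * c
sumTo-const zero    f c fx≡c = refl
sumTo-const (suc m) f c fx≡c = cong₂ _+_ (fx≡c z<s) (sumTo-const m (f ∘ suc) c (fx≡c ∘ s<s))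

sum-positions : ∀ n (f : ℕ → ℕ) → sum (List.map (f ∘ toℕ) (allFin n)) ≡ sumTo n f
sum-positions n f = trans (cong sum (map-tabulate {n = n} id (f ∘ toℕ))) (sum-tabulate n f)
  where
  sum-tabulate : ∀ n (f : ℕ → ℕ) → sum (List.tabulate {n = n} (f ∘ toℕ)) ≡ sumTo n f
  sum-tabulate zero    f = refl
  sum-tabulate (suc n) f = cong (f 0 +_) (sum-tabulate n (f ∘ suc))

∣tabulate∣ : ∀ n (f : ℕ → Bool) →
  ∣ Vec.tabulate {n = n} (f ∘ toℕ) ∣ ≡ sumTo n (λ x → if f x then 1 else 0)
∣tabulate∣ zero    f = refl
∣tabulate∣ (suc n) f with f 0
... | true  = cong suc (∣tabulate∣ n (f ∘ suc))
... | false = ∣tabulate∣ n (f ∘ suc)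

joined : Part → Part → ℕ
joined p q = if partAdj p q then 1 else 0

-- Orientation of the block edges C→v, C→A, A→B; it agrees with position order.
below : Part → Part → Bool
below pC pv = true
below pC pA = true
below pA pB = true
below _  _  = false

side : Part → Bool
side pC = true
side pv = false
side pA = false
side pB = true

crosses : ∀ p q → partAdj p q ≡ true → side p ≢ side q
crosses pC pv _ = λ ()
crosses pC pA _ = λ ()
crosses pv pC _ = λ ()
crosses pA pC _ = λ ()
crosses pA pB _ = λ ()
crosses pB pA _ = λ ()
crosses pC pC ()
crosses pC pB ()
crosses pv pv ()
crosses pv pA ()
crosses pv pB ()
crosses pA pv ()
crosses pA pA ()
crosses pB pC ()
crosses pB pv ()
crosses pB pB ()

joined-to-v : ∀ p → partAdj pv p ≡ true → p ≡ pC
joined-to-v pC _ = refl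
joined-to-v pv ()
joined-to-v pA ()
joined-to-v pB ()

joined-to-B : ∀ p → partAdj pB p ≡ true → p ≡ pA
joined-to-B pA _ = refl
joined-to-B pC ()
joined-to-B pv ()
joined-to-B pB ()

blockSum : (k A b : ℕ) → (Part → ℕ) → ℕ
blockSum k A b g = k * g pC + g pv + A * g pA + b * g pB

degree : (k A b : ℕ) → Part → ℕ
degree k A b pC = suc A
degree k A b pv = k
degree k A b pA = k + b
degree k A b pB = A

m1 : ℕ → ℕ → ℕ → ℕ
m1 k A b = k * (suc A * suc A) + k * k + A * ((k + b) * (k + b)) + b * (A * A)

-- M₂(G(A,b)): k edges C–v, k·A edges C–A and A·b edges A–B.
m2 : ℕ → ℕ → ℕ → ℕ
m2 k A b = k * (suc A * k) + k * A * (suc A * (k + b)) + A * b * ((k + b) * A)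

-- The graph G(A,b) on n = k + 1 + A + b vertices, with r = k + b.
module Layout (k A b : ℕ) where

  n : ℕ
  n = k + suc (A + b)

  G : Graph n
  G = Okv1 n (k + b) k

  P : ℕ → Part
  P = part n (k + b) k

  Q : Fin n → Part
  Q = P ∘ toℕ

  d : Part → ℕ
  d = degree k A b

  A-end : k + (n ∸ (k + b) ∸ 1) ≡ k + A
  A-end = cong (λ t → k + (t ∸ 1))
    (trans ([m+n]∸[m+o]≡n∸o k (suc (A + b)) b) (m+n∸n≡m (suc A) b))

  in-C : ∀ {x} → x < k → P x ≡ pC
  in-C x<k rewrite true-if-T (<⇒<ᵇ x<k) = refl

  at-v : P k ≡ pv
  at-v rewrite false-if-¬T (<-irrefl refl ∘ <ᵇ⇒< k k) | true-if-T (≡⇒≡ᵇ k k refl) = refl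

  past-v : ∀ {x} → k < x → P x ≡ (if x ≤ᵇ k + (n ∸ (k + b) ∸ 1) then pA else pB)
  past-v {x} k<x
    rewrite false-if-¬T (<⇒≯ k<x ∘ <ᵇ⇒< x k) | false-if-¬T (<⇒≢ k<x ∘ sym ∘ ≡ᵇ⇒≡ x k) = refl

  in-A : ∀ {x} → k < x → x ≤ k + A → P x ≡ pA
  in-A {x} k<x x≤k+A = trans (past-v k<x)
    (cong (λ t → if t then pA else pB) (true-if-T (≤⇒≤ᵇ (subst (x ≤_) (sym A-end) x≤k+A))))

  in-B : ∀ {x} → k + A < x → P x ≡ pB
  in-B {x} k+A<x = trans (past-v (≤-<-trans (m≤m+n k A) k+A<x))
    (cong (λ t → if t then pA else pB)
      (false-if-¬T (<⇒≱ (subst (_< x) (sym A-end) k+A<x) ∘ ≤ᵇ⇒≤ x _)))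

  A-member : ∀ {x} → x < A → P (k + suc x) ≡ pA
  A-member x<A = in-A (m<m+n k z<s) (+-monoʳ-≤ k x<A)

  B-member : ∀ x → P (k + suc (A + x)) ≡ pB
  B-member x = in-B (+-monoʳ-< k (s≤s (m≤m+n A x)))

  data Position (x : ℕ) : Part → Set where
    inC : x < k → Position x pC
    atv : x ≡ k → Position x pv
    inA : k < x → x ≤ k + A → Position x pA
    inB : k + A < x → Position x pB

  position : ∀ x → Position x (P x)
  position x with <-cmp x k
  ... | tri< x<k _ _ = subst (Position x) (sym (in-C x<k)) (inC x<k)
  ... | tri≈ _ refl _ = subst (Position k) (sym at-v) (atv refl)
  ... | tri> _ _ k<x with x ≤? k + A
  ...   | yes x≤k+A = subst (Position x) (sym (in-A k<x x≤k+A)) (inA k<x x≤k+A)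
  ...   | no  x≰k+A = subst (Position x) (sym (in-B (≰⇒> x≰k+A))) (inB (≰⇒> x≰k+A))

  sum-by-block : ∀ (g : Part → ℕ) → sumTo n (g ∘ P) ≡ blockSum k A b g
  sum-by-block g = begin
      sumTo (k + suc (A + b)) (g ∘ P)
    ≡⟨ sumTo-+ k (suc (A + b)) (g ∘ P) ⟩
      sumTo k (g ∘ P) + (g (P (k + 0)) + sumTo (A + b) (λ x → g (P (k + suc x))))
    ≡⟨ cong₂ _+_ C-part (cong₂ _+_ v-part (sumTo-+ A b _)) ⟩
      k * g pC + (g pv + (sumTo A (λ x → g (P (k + suc x)))
                          + sumTo b (λ x → g (P (k + suc (A + x))))))
    ≡⟨ cong (λ t → k * g pC + (g pv + t)) (cong₂ _+_ A-part B-part) ⟩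
      k * g pC + (g pv + (A * g pA + b * g pB))
    ≡⟨ sym (trans (+-assoc (k * g pC + g pv) _ _) (+-assoc (k * g pC) _ _)) ⟩
      blockSum k A b g
    ∎
    where
    C-part = sumTo-const k _ (g pC) (cong g ∘ in-C)
    v-part = cong g (trans (cong P (+-identityʳ k)) at-v)
    A-part = sumTo-const A _ (g pA) (cong g ∘ A-member)
    B-part = sumTo-const b _ (g pB) (λ {x} _ → cong g (B-member x))

  degree-count : ∀ p → blockSum k A b (joined p) ≡ d p
  degree-count pC = begin k * 0 + 1 + A * 1 + b * 0 ≡⟨ solve (k ∷ A ∷ b ∷ []) ⟩ suc A ∎
  degree-count pv = begin k * 1 + 0 + A * 0 + b * 0 ≡⟨ solve (k ∷ A ∷ b ∷ []) ⟩ k ∎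
  degree-count pA = begin k * 1 + 0 + A * 0 + b * 1 ≡⟨ solve (k ∷ A ∷ b ∷ []) ⟩ k + b ∎
  degree-count pB = begin k * 0 + 0 + A * 1 + b * 0 ≡⟨ solve (k ∷ A ∷ b ∷ []) ⟩ A ∎

  deg-G : ∀ i → deg G i ≡ d (Q i)
  deg-G i = begin
    deg G i                       ≡⟨ sum-positions n (joined (Q i) ∘ P) ⟩
    sumTo n (joined (Q i) ∘ P)    ≡⟨ sum-by-block (joined (Q i)) ⟩
    blockSum k A b (joined (Q i)) ≡⟨ degree-count (Q i) ⟩
    d (Q i)                       ∎

  M1-G : M1 G ≡ m1 k A b
  M1-G = begin
    M1 G                                               ≡⟨ cong sum (map-cong (λ i → cong₂ _*_ (deg-G i) (deg-G i)) (allFin n)) ⟩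
    sum (List.map (λ i → d (Q i) * d (Q i)) (allFin n)) ≡⟨ sum-positions n (λ x → d (P x) * d (P x)) ⟩
    sumTo n (λ x → d (P x) * d (P x))                   ≡⟨ sum-by-block (λ p → d p * d p) ⟩
    m1 k A b                                           ∎

  order-on-edges : ∀ x y →
    (partAdj (P x) (P y) ∧ (x <ᵇ y)) ≡ (partAdj (P x) (P y) ∧ below (P x) (P y))
  order-on-edges x y with P x | position x | P y | position y
  ... | pC | inC x<k       | pC | _              = refl
  ... | pC | inC x<k       | pv | atv refl       = true-if-T (<⇒<ᵇ x<k)
  ... | pC | inC x<k       | pA | inA k<y _      = true-if-T (<⇒<ᵇ (<-trans x<k k<y))
  ... | pC | _             | pB | _              = refl
  ... | pv | atv refl      | pC | inC y<k        = false-if-¬T (<⇒≯ y<k ∘ <ᵇ⇒< k y)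
  ... | pv | _             | pv | _              = refl
  ... | pv | _             | pA | _              = refl
  ... | pv | _             | pB | _              = refl
  ... | pA | inA k<x _     | pC | inC y<k        = false-if-¬T (<⇒≯ (<-trans y<k k<x) ∘ <ᵇ⇒< x y)
  ... | pA | _             | pv | _              = refl
  ... | pA | _             | pA | _              = refl
  ... | pA | inA _ x≤k+A   | pB | inB k+A<y      = true-if-T (<⇒<ᵇ (≤-<-trans x≤k+A k+A<y))
  ... | pB | _             | pC | _              = refl
  ... | pB | _             | pv | _              = refl
  ... | pB | inB k+A<x     | pA | inA _ y≤k+A    = false-if-¬T (<⇒≯ (≤-<-trans y≤k+A k+A<x) ∘ <ᵇ⇒< x y)
  ... | pB | _             | pB | _              = refl

  -- The contribution of the pair of blocks (p, q) to M₂; each edge is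
  -- counted once, from its lower endpoint.
  edge-weight : Part → Part → ℕ
  edge-weight p q = if partAdj p q ∧ below p q then d p * d q else 0

  M2-term : ∀ i j →
    (if adj G i j ∧ (toℕ i <ᵇ toℕ j) then deg G i * deg G j else 0) ≡ edge-weight (Q i) (Q j)
  M2-term i j = cong₂ (λ c t → if c then t else 0)
    (order-on-edges (toℕ i) (toℕ j)) (cong₂ _*_ (deg-G i) (deg-G j))

  M2-row : ∀ i →
    sum (List.map (λ j → if adj G i j ∧ (toℕ i <ᵇ toℕ j) then deg G i * deg G j else 0) (allFin n))
      ≡ blockSum k A b (edge-weight (Q i))
  M2-row i = begin
    _                                           ≡⟨ cong sum (map-cong (M2-term i) (allFin n)) ⟩
    sum (List.map (edge-weight (Q i) ∘ Q) (allFin n)) ≡⟨ sum-positions n (edge-weight (Q i) ∘ P) ⟩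
    sumTo n (edge-weight (Q i) ∘ P)             ≡⟨ sum-by-block (edge-weight (Q i)) ⟩
    blockSum k A b (edge-weight (Q i))          ∎

  m2-count : blockSum k A b (λ p → blockSum k A b (edge-weight p)) ≡ m2 k A b
  m2-count = begin
      k * (k * 0 + suc A * k + A * (suc A * (k + b)) + b * 0) + (k * 0 + 0 + A * 0 + b * 0)
        + A * (k * 0 + 0 + A * 0 + b * ((k + b) * A)) + b * (k * 0 + 0 + A * 0 + b * 0)
    ≡⟨ solve (k ∷ A ∷ b ∷ []) ⟩
      k * (suc A * k) + k * A * (suc A * (k + b)) + A * b * ((k + b) * A)
    ∎

  M2-G : M2 G ≡ m2 k A b
  M2-G = begin
    M2 G                                                    ≡⟨ cong sum (map-cong M2-row (allFin n)) ⟩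
    sum (List.map (λ i → blockSum k A b (edge-weight (Q i))) (allFin n))
      ≡⟨ sum-positions n (λ x → blockSum k A b (edge-weight (P x))) ⟩
    sumTo n (λ x → blockSum k A b (edge-weight (P x)))      ≡⟨ sum-by-block (λ p → blockSum k A b (edge-weight p)) ⟩
    blockSum k A b (λ p → blockSum k A b (edge-weight p))   ≡⟨ m2-count ⟩
    m2 k A b                                                ∎

  bipartite : Bipartite G
  bipartite = side ∘ Q , λ i j → crosses (Q i) (Q j)

  block-edge : ∀ {u w p q} → Q u ≡ p → Q w ≡ q → partAdj p q ≡ true → Adj G u w
  block-edge refl refl pq = pq

  next-to : Part → Subset n
  next-to p = Vec.tabulate (λ i → partAdj p (Q i))

  ∣next-to∣ : ∀ p → ∣ next-to p ∣ ≡ d p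
  ∣next-to∣ p = begin
    ∣ next-to p ∣                ≡⟨ ∣tabulate∣ n (partAdj p ∘ P) ⟩
    sumTo n (joined p ∘ P)       ≡⟨ sum-by-block (joined p) ⟩
    blockSum k A b (joined p)    ≡⟨ degree-count p ⟩
    d p                          ∎

  connectivity≤degree : ∀ {m u w p q} → KConnected G m →
    Q u ≡ p → Q w ≡ q → p ≢ q → partAdj p q ≡ false → m ≤ d p
  connectivity≤degree {u = u} κ refl refl p≢q pq≡false =
    subst (_ ≤_) (∣next-to∣ (Q u))
      (connectivity≤neighbourhood κ (λ w≡u → p≢q (sym (cong Q w≡u)))
                                    (λ pq → false≢true (trans (sym pq≡false) pq)))

  to-hub : ∀ {X c a x} → Q c ≡ pC → c ∉ X → Q a ≡ pA → a ∉ X → x ∉ X → ReachAvoid G X x c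
  to-hub {X} {c} {a} {x} c∈C c∉X a∈A a∉X x∉X = route (Q x) refl
    where
    a→c : ReachAvoid G X a c
    a→c = step a∉X (block-edge a∈A c∈C refl) (here c∉X)
    route : ∀ p → Q x ≡ p → ReachAvoid G X x c
    route pC x∈C = step x∉X (block-edge x∈C a∈A refl) a→c
    route pv x≡v = step x∉X (block-edge x≡v c∈C refl) (here c∉X)
    route pA x∈A = step x∉X (block-edge x∈A c∈C refl) (here c∉X)
    route pB x∈B = step x∉X (block-edge x∈B a∈A refl) a→c

  -- Deleting fewer than k ≤ A vertices leaves some C- and some A-vertex,
  -- through which G − X is connected.
  k-connected : k ≤ A → KConnected G k
  k-connected k≤A = m<m+n k z<s , connected
    where
    connected : ∀ X → ∣ X ∣ < k → ConnectedMinus G X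
    connected X X<k u w u∉X w∉X
      with outside (next-to pv) X (subst (∣ X ∣ <_) (sym (∣next-to∣ pv)) X<k)
         | outside (next-to pB) X (subst (∣ X ∣ <_) (sym (∣next-to∣ pB)) (<-≤-trans X<k k≤A))
    ... | c , c∈next-to-v , c∉X | a , a∈next-to-B , a∉X =
      walk-++ (to-hub c∈C c∉X a∈A a∉X u∉X) (walk-reverse (to-hub c∈C c∉X a∈A a∉X w∉X))
      where
      c∈C = joined-to-v (Q c) (∈-tabulate c∈next-to-v)
      a∈A = joined-to-B (Q a) (∈-tabulate a∈next-to-B)

  v₀ : Fin n
  v₀ = fromℕ< (m<m+n k z<s)

  v₀∈v : Q v₀ ≡ pv
  v₀∈v = trans (cong P (toℕ-fromℕ< (m<m+n k z<s))) at-v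

  a₀ : 1 ≤ A → Fin n
  a₀ 1≤A = fromℕ< (+-monoʳ-< k (s≤s (≤-trans 1≤A (m≤m+n A b))))

  a₀∈A : (1≤A : 1 ≤ A) → Q (a₀ 1≤A) ≡ pA
  a₀∈A 1≤A = trans (cong P (toℕ-fromℕ< _)) (A-member 1≤A)

  b₀ : 1 ≤ b → Fin n
  b₀ 1≤b = fromℕ< (+-monoʳ-< k (s≤s (+-monoʳ-< A 1≤b)))

  b₀∈B : (1≤b : 1 ≤ b) → Q (b₀ 1≤b) ≡ pB
  b₀∈B 1≤b = trans (cong P (toℕ-fromℕ< _)) (B-member 0)

  -- κ(G) ≤ k: N(v) = C, and an A-vertex survives its deletion.
  connectivity≤k : 1 ≤ A → ∀ m → KConnected G m → m ≤ k
  connectivity≤k 1≤A m κ = connectivity≤degree κ v₀∈v (a₀∈A 1≤A) (λ ()) refl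

  in-class : 1 ≤ A → k ≤ A → InV n k G
  in-class 1≤A k≤A = bipartite , k-connected k≤A , connectivity≤k 1≤A

  -- Conversely, if B is nonempty, membership forces k ≤ A: N(B) = A separates B from v.
  needs-A : 1 ≤ b → InV n k G → k ≤ A
  needs-A 1≤b (_ , κ , _) = connectivity≤degree κ (b₀∈B 1≤b) v₀∈v (λ ()) refl

-- The facts above for a vertex count n merely equal to k + 1 + A + b.
module Shaped {n : ℕ} (k A b : ℕ) (shape : n ≡ k + suc (A + b)) where

  M1-closed : M1 (Okv1 n (k + b) k) ≡ m1 k A b
  M1-closed rewrite shape = Layout.M1-G k A b

  M2-closed : M2 (Okv1 n (k + b) k) ≡ m2 k A b
  M2-closed rewrite shape = Layout.M2-G k A b

  in-class : 1 ≤ A → k ≤ A → InV n k (Okv1 n (k + b) k)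
  in-class rewrite shape = Layout.in-class k A b

exceeds : ∀ {x y r} → y ≡ x + suc r → x < y
exceeds y≡x+r = subst (_ <_) (sym y≡x+r) (m<m+n _ z<s)

far-gain : ∀ k b c → let A = k + (2 + b + c) in
  m1 k (suc A) b < m1 k A (suc b) × m2 k (suc A) b < m2 k A (suc b)
far-gain k b c = exceeds (m1-excess k b c) , exceeds (m2-excess k b c)
  where
  m1-excess : ∀ k b c → let A = k + (2 + b + c) in
    k * (suc A * suc A) + k * k + A * ((k + suc b) * (k + suc b)) + suc b * (A * A)
      ≡ k * (suc (suc A) * suc (suc A)) + k * k + suc A * ((k + b) * (k + b)) + b * (suc A * suc A)
        + (6 + 5 * c + c * c + 4 * b + 2 * b * c + 2 * k + 2 * k * c)
  m1-excess = solve-∀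
  m2-excess : ∀ k b c → let A = k + (2 + b + c) in
    k * (suc A * k) + k * A * (suc A * (k + suc b)) + A * suc b * ((k + suc b) * A)
      ≡ k * (suc (suc A) * k) + k * suc A * (suc (suc A) * (k + b)) + suc A * b * ((k + b) * suc A)
        + (4 + 4 * c + c * c + 12 * b + 10 * b * c + 2 * b * c * c + 4 * b * b + 2 * b * b * c
           + 14 * k + 11 * k * c + 2 * k * c * c + 8 * k * b + 4 * k * b * c + 3 * k * k + 2 * k * k * c)
  m2-excess = solve-∀

near-gain : ∀ k d e → let A = k + d; b = d + 1 + e in
  m1 k A (suc b) < m1 k (suc A) b × m2 k A (suc b) < m2 k (suc A) b
near-gain k d e = exceeds (m1-excess k d e) , exceeds (m2-excess k d e)
  where
  m1-excess : ∀ k d e → let A = k + d; b = d + 1 + e in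
    k * (suc (suc A) * suc (suc A)) + k * k + suc A * ((k + b) * (k + b)) + b * (suc A * suc A)
      ≡ k * (suc A * suc A) + k * k + A * ((k + suc b) * (k + suc b)) + suc b * (A * A)
        + (2 + 3 * e + e * e + 2 * d + 2 * d * e + 4 * k + 2 * k * e)
  m1-excess = solve-∀
  m2-excess : ∀ k d e → let A = k + d; b = d + 1 + e in
    k * (suc (suc A) * k) + k * suc A * (suc (suc A) * (k + b)) + suc A * b * ((k + b) * suc A)
      ≡ k * (suc A * k) + k * A * (suc A * (k + suc b)) + A * suc b * ((k + suc b) * A)
        + (1 + 2 * e + e * e + 4 * d + 6 * d * e + 2 * d * e * e + 2 * d * d + 2 * d * d * e
           + 5 * k + 7 * k * e + 2 * k * e * e + 4 * k * d + 4 * k * d * e + 3 * k * k + 2 * k * k * e)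
  m2-excess = solve-∀

NotExtremal : ℕ → ℕ → ℕ → Set
NotExtremal n k r = ¬ AttainsMax n k M1 (Okv1 n r k) × ¬ AttainsMax n k M2 (Okv1 n r k)

outdone : ∀ {n} k A b A′ b′ → n ≡ k + suc (A + b) → n ≡ k + suc (A′ + b′) → 1 ≤ A′ → k ≤ A′ →
  m1 k A b < m1 k A′ b′ × m2 k A b < m2 k A′ b′ → NotExtremal n k (k + b)
outdone k A b A′ b′ G-shape H-shape 1≤A′ k≤A′ (m1-gain , m2-gain) =
    beaten M1 H∈𝒱 (subst₂ _<_ (sym G.M1-closed) (sym H.M1-closed) m1-gain)
  , beaten M2 H∈𝒱 (subst₂ _<_ (sym G.M2-closed) (sym H.M2-closed) m2-gain)
  where
  module G = Shaped k A b G-shape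
  module H = Shaped k A′ b′ H-shape
  H∈𝒱 = H.in-class 1≤A′ k≤A′

layout : ∀ {n k r} → k ≤ r → r + 1 ≤ n → ∃₂ λ A b → r ≡ k + b × n ≡ k + suc (A + b)
layout {k = k} k≤r r<n with m≤n⇒∃[o]m+o≡n k≤r
... | b , refl with m≤n⇒∃[o]m+o≡n r<n
...   | A , refl = A , b , refl , solve (k ∷ b ∷ A ∷ [])

far-split : ∀ {k A b} → 2 * (k + b) + 4 ≤ k + suc (A + b) → ∃ λ c → A ≡ suc (k + (2 + b + c))
far-split {k} {A} {b} far with m≤n⇒∃[o]m+o≡n far
... | c , 2r+4+c≡n = c , +-cancelˡ-≡ (k + b + 1) A _ (begin
    k + b + 1 + A                    ≡⟨ solve (k ∷ b ∷ A ∷ []) ⟩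
    k + suc (A + b)                  ≡⟨ sym 2r+4+c≡n ⟩
    2 * (k + b) + 4 + c              ≡⟨ solve (k ∷ b ∷ c ∷ []) ⟩
    k + b + 1 + suc (k + (2 + b + c)) ∎)

near-split : ∀ {k d b} → k + suc (k + d + suc b) < 2 * (k + suc b) → ∃ λ e → b ≡ d + 1 + e
near-split {k} {d} {b} near with m≤n⇒∃[o]m+o≡n near
... | e , n+1+e≡2r = e , sym (+-cancelˡ-≡ (k + k + b + 2) _ _ (begin
    k + k + b + 2 + (d + 1 + e)      ≡⟨ solve (k ∷ b ∷ d ∷ e ∷ []) ⟩
    suc (k + suc (k + d + suc b)) + e ≡⟨ n+1+e≡2r ⟩
    2 * (k + suc b)                  ≡⟨ solve (k ∷ b ∷ []) ⟩
    k + k + b + 2 + b                ∎))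

far-regime : ∀ {n k A b} → n ≡ k + suc (A + b) → 2 * (k + b) + 4 ≤ n → NotExtremal n k (k + b)
far-regime {k = k} {A} {b} refl far with far-split {k} {A} {b} far
... | c , refl = outdone k (suc A′) b A′ (suc b) refl H-shape
    (≤-trans (s≤s z≤n) (m≤n+m (2 + b + c) k)) (m≤m+n k (2 + b + c))
    (far-gain k b c)
  where
  A′ = k + (2 + b + c)
  H-shape : k + suc (suc A′ + b) ≡ k + suc (A′ + suc b)
  H-shape = cong (λ t → k + suc t) (sym (+-suc A′ b))

-- If n < 2r and 2k + 2 ≤ n, then b ≥ 2 (b = 0 would give 2k + 2 ≤ n < 2k),
-- membership gives k ≤ A, and G(A+1, b−1) ∈ 𝒱ⁿ_k beats G(A, b) for M₁ and M₂.
near-regime : ∀ {n k A b} → n ≡ k + suc (A + b) → 2 * k + 2 ≤ n → n < 2 * (k + b) →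
  InV n k (Okv1 n (k + b) k) → NotExtremal n k (k + b)
near-regime {k = k} {b = zero} _ 2k+2≤n n<2k _ =
  ⊥-elim (<⇒≱ (≤-<-trans 2k+2≤n n<2k) (≤-trans (≤-reflexive (cong (2 *_) (+-identityʳ k))) (m≤m+n (2 * k) 2)))
near-regime {k = k} {A} {suc b} refl _ near G∈𝒱 with m≤n⇒∃[o]m+o≡n (Layout.needs-A k A (suc b) (s≤s z≤n) G∈𝒱)
... | d , refl with near-split {k} {d} {b} near
...   | e , refl = outdone k (k + d) (suc b′) (suc (k + d)) b′ refl H-shape
    (s≤s z≤n) (m≤n⇒m≤1+n (m≤m+n k d))
    (near-gain k d e)
  where
  b′ = d + 1 + e
  H-shape : k + suc (k + d + suc b′) ≡ k + suc (suc (k + d) + b′)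
  H-shape = cong (λ t → k + suc t) (+-suc (k + d) b′)

lemma2p5 : (n k r : ℕ) → 6 ≤ n → 1 ≤ k → 2 * k + 2 ≤ n →
    k ≤ r → r + 1 ≤ n → InV n k (Okv1 n r k) →
    (2 * r + 4 ≤ n ⊎ n < 2 * r) →
    ¬ AttainsMax n k M1 (Okv1 n r k) × ¬ AttainsMax n k M2 (Okv1 n r k)
lemma2p5 n k r _ _ 2k+2≤n k≤r r<n G∈𝒱 regime with layout k≤r r<n
... | A , b , refl , shape with regime
...   | inj₁ far  = far-regime shape far
...   | inj₂ near = near-regime shape 2k+2≤n near G∈𝒱
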